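{- Let $G$ and $G'$ be non-isomorphic triconnected planar graphs, $G$ with $n$ vertices, $C$ a collocated configuration in $G$ and $C'$ a twisted configuration in $G'$. Consider a position of the Ehrenfeucht–Fraïssé game in which the vertices of $C$ and $C'$ with the same label are covered by the same pebble, and additionally $s,t,c\in V(G)$ and $s',t',c'\in V(G')$ are pebbled correspondingly, with $d_0(s,t)=d_0(s',t')$, where either $c$ is a cutpoint of $G[S_0(s,t)]$ and $c'$ is not a cutpoint of $G'[S_0(s',t')]$, or $c'$ is a cutpoint of $G'[S_0(s',t')]$ and $c$ is not a cutpoint of $G[S_0(s,t)]$. Then from this position Spoiler wins with 12 pebbles in fewer than $2\log_2 n+2$ rounds.
   Context: An $X$-configuration is a set of 5 pairwise distinct vertices labelled $x,y,u,v,w$ with $x,y,u,v$ adjacent to $w$; an $H$-configuration is a set of 6 pairwise distinct vertices labelled $x,y,z,u,v,w$ with $z$ adjacent to $w$, $x,y$ adjacent to $z$, $u,v$ adjacent to $w$; for an $X$-configuration set $z=w$. In a triconnected planar graph (unique spherical embedding up to equivalence by Whitney's theorem), an $X$-configuration is collocated if $u,x,y,v$ occur around $w$ in this cyclic order (up to cyclic shift and reversal); an $H$-configuration is collocated if $x,z,w,u$ and $y,z,w,v$ are segments of the two facial cycles containing the edge $zw$. A twisted configuration is obtained from a collocated one by swapping labels $x$ and $y$. A path avoids a configuration if none of its non-endpoint vertices lies in it; $d_0(a,b)$ (in $G$ w.r.t. $C$, in $G'$ w.r.t. $C'$) is the minimum length of an $a$-$b$-path avoiding the configuration, and $S_0(a,b)$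 is the set of vertices on at least one such path of length $d_0(a,b)$. A cutpoint of a connected graph is a vertex whose removal disconnects it. Game: each pebble has two copies; in each round Spoiler places (possibly moves) a copy of some pebble on a vertex of one graph and Duplicator places the other copy in the other graph; Duplicator wins as long as the correspondence between vertices carrying the same pebble is a partial isomorphism (respects equality and adjacency); Spoiler wins within $r$ rounds if he can force failure within $r$ rounds against any Duplicator strategy. -}

module Defs where

open import Data.Nat using (ℕ; zero; suc; _+_; _*_; _∸_; _^_; _<_; _≤_; _≤ᵇ_)
open import Data.Bool using (Bool; true; false; _∧_; if_then_else_)
open import Data.Fin using (Fin; toℕ; _<?_)
open import Data.Fin.Properties using (_≟_)
open import Data.List using (List; []; _∷_; length; filter; allFin; cartesianProduct; upTo; foldr)
open import Data.List.Membership.Propositional using (_∈_)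
open import Data.List.Relation.Unary.All using (All)
open import Data.List.Relation.Unary.Unique.Propositional using (Unique)
open import Data.Maybe using (Maybe; just; nothing)
open import Data.Product using (Σ; ∃; ∃-syntax; _×_; _,_; proj₁; proj₂)
open import Data.Sum using (_⊎_)
open import Data.Empty using (⊥)
open import Data.Unit using (⊤)
open import Function using (_∘_)
open import Function.Bundles using (_⤖_; Bijection)
open import Relation.Nullary using (¬_; does)
open import Relation.Binary.PropositionalEquality using (_≡_; _≢_)

record Graph (n : ℕ) : Set where
  field
    adj     : Fin n → Fin n → Bool
    adj-sym : ∀ a b → adj a b ≡ adj b a
    adj-irr : ∀ a → adj a a ≡ false
open Graph public

Adj : ∀ {n} → Graph n → Fin n → Fin n → Set
Adj G a b = adj G a b ≡ true

Isomorphic : ∀ {n n'} → Graph n → Graph n' → Set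
Isomorphic {n} {n'} G G' =
  Σ (Fin n ⤖ Fin n') λ f →
    ∀ a b → adj G' (Bijection.to f a) (Bijection.to f b) ≡ adj G a b

data Walk {n} (G : Graph n) : Fin n → Fin n → List (Fin n) → Set where
  [_] : ∀ a → Walk G a a (a ∷ [])
  _∷_ : ∀ {a b c vs} → Adj G a b → Walk G b c vs → Walk G a c (a ∷ vs)

Path : ∀ {n} → Graph n → Fin n → Fin n → List (Fin n) → Set
Path G a b vs = Walk G a b vs × Unique vs

len : ∀ {A : Set} → List A → ℕ
len vs = length vs ∸ 1

dropLast : ∀ {A : Set} → List A → List A
dropLast []           = []
dropLast (x ∷ [])     = []
dropLast (x ∷ y ∷ ys) = x ∷ dropLast (y ∷ ys)

interior : ∀ {A : Set} → List A → List A
interior []       = []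
interior (x ∷ xs) = dropLast xs

Connected : ∀ {n} → Graph n → Set
Connected {n} G = ∀ (a b : Fin n) → ∃[ vs ] Walk G a b vs

-- G - {p,q} is connected (p = q allowed, so this covers removing
-- one or two vertices)
ConnectedWithout : ∀ {n} → Graph n → Fin n → Fin n → Set
ConnectedWithout {n} G p q =
  ∀ (a b : Fin n) → a ≢ p → a ≢ q → b ≢ p → b ≢ q →
    ∃[ vs ] (Walk G a b vs × All (λ v → v ≢ p × v ≢ q) vs)

Triconnected : ∀ {n} → Graph n → Set
Triconnected {n} G = 4 ≤ n × Connected G × (∀ p q → ConnectedWithout G p q)

iter : ∀ {A : Set} → ℕ → (A → A) → A → A
iter zero    f a = a
iter (suc k) f a = f (iter k f a)

-- rot v u = the neighbour of v following u in the cyclic order around v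
record Rotation {n} (G : Graph n) : Set where
  field
    rot     : Fin n → Fin n → Fin n
    rot-adj : ∀ v u → Adj G v u → Adj G v (rot v u)
    rot-cyc : ∀ v u u' → Adj G v u → Adj G v u' → ∃[ k ] iter k (rot v) u ≡ u'
open Rotation public

Dart : ℕ → Set
Dart n = Fin n × Fin n

allᵇ : ∀ {A : Set} → (A → Bool) → List A → Bool
allᵇ f = foldr (λ a b → f a ∧ b) true

faceStep : ∀ {n} {G : Graph n} → Rotation G → Dart n → Dart n
faceStep R (u , v) = (v , rot R v u)

dartKey : ∀ {n} → Dart n → ℕ
dartKey {n} (u , v) = toℕ u * n + toℕ v

-- a dart is the representative of its face if it is a dart of G and it
-- has the least key in its faceStep-orbit (orbits have at most n*n darts)
isFaceRep : ∀ {n} {G : Graph n} → Rotation G → Dart n → Bool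
isFaceRep {n} {G} R d =
  adj G (proj₁ d) (proj₂ d) ∧
  allᵇ (λ k → dartKey d ≤ᵇ dartKey (iter k (faceStep R) d)) (upTo (n * n))

allDarts : ∀ n → List (Dart n)
allDarts n = cartesianProduct (allFin n) (allFin n)

numFaces : ∀ {n} {G : Graph n} → Rotation G → ℕ
numFaces {n} R = length (filter (λ d → isFaceRep R d ≡? true) (allDarts n))
  where
    open import Data.Bool.Properties using () renaming (_≟_ to _≡?_)

numEdges : ∀ {n} → Graph n → ℕ
numEdges {n} G =
  length (filter (λ d → (proj₁ d <? proj₂ d)) (Data.List.filter (λ d → adj G (proj₁ d) (proj₂ d) ≡? true) (allDarts n)))
  where
    import Data.List
    open import Data.Bool.Properties using () renaming (_≟_ to _≡?_)

-- a planar (spherical) embedding of a connected graph: a rotation system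
-- of genus 0, i.e. satisfying Euler's formula V - E + F = 2
IsPlanarEmbedding : ∀ {n} {G : Graph n} → Rotation G → Set
IsPlanarEmbedding {n} {G} R = n + numFaces R ≡ 2 + numEdges G

Planar : ∀ {n} → Graph n → Set
Planar G = Σ (Rotation G) IsPlanarEmbedding

data Kind : Set where
  X H : Kind

ValidConfig : ∀ {n} → Graph n → Kind → (x y z u v w : Fin n) → Set
ValidConfig G X x y z u v w =
  z ≡ w × Unique (x ∷ y ∷ u ∷ v ∷ w ∷ []) ×
  Adj G x w × Adj G y w × Adj G u w × Adj G v w
ValidConfig G H x y z u v w =
  Unique (x ∷ y ∷ z ∷ u ∷ v ∷ w ∷ []) ×
  Adj G z w × Adj G x z × Adj G y z × Adj G u w × Adj G v w

record Config {n} (G : Graph n) (k : Kind) : Set where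
  field
    x y z u v w : Fin n
    valid : ValidConfig G k x y z u v w
open Config public

InConfig : ∀ {n} {G : Graph n} {k} → Config G k → Fin n → Set
InConfig C a =
  a ≡ x C ⊎ a ≡ y C ⊎ a ≡ z C ⊎ a ≡ u C ⊎ a ≡ v C ⊎ a ≡ w C

-- distinct neighbours a b c d of w occur in this cyclic order around w
-- (starting at a and going once around in the rotation direction)
CyclicOrder4 : ∀ {n} {G : Graph n} → Rotation G → (w a b c d : Fin n) → Set
CyclicOrder4 R w a b c d =
  ∃[ i ] ∃[ j ] ∃[ l ] (0 < i × i < j × j < l ×
    iter i (rot R w) a ≡ b × iter j (rot R w) a ≡ c × iter l (rot R w) a ≡ d ×
    (∀ m → 0 < m → m ≤ l → iter m (rot R w) a ≢ a))

-- X: u,x,y,v occur around w in this cyclic order, up to reversal.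
-- H: the two faces containing the edge zw are traced (faceStep) as
--    ... p z w q ...  with rot z p = w, q = rot w z, and
--    ... q' w z p' ... with rot w q' = z, p' = rot z w;
--    x,z,w,u is a segment of one of them and y,z,w,v of the other.
CollocatedWrt : ∀ {n} {G : Graph n} → Rotation G → Kind → (x y z u v w : Fin n) → Set
CollocatedWrt R X x y z u v w = CyclicOrder4 R w u x y v ⊎ CyclicOrder4 R w u v y x
CollocatedWrt R H x y z u v w =
  (rot R z x ≡ w × rot R w z ≡ u × rot R z w ≡ y × rot R w v ≡ z) ⊎
  (rot R z y ≡ w × rot R w z ≡ v × rot R z w ≡ x × rot R w u ≡ z)

-- collocated: w.r.t. the planar embedding of G (unique up to
-- reflection for triconnected planar graphs, by Whitney's theorem)
Collocated : ∀ {n} {G : Graph n} {k} → Config G k → Set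
Collocated {G = G} {k} C =
  Σ (Rotation G) λ R → IsPlanarEmbedding R × CollocatedWrt R k (x C) (y C) (z C) (u C) (v C) (w C)

Twisted : ∀ {n} {G : Graph n} {k} → Config G k → Set
Twisted {G = G} {k} C =
  Σ (Rotation G) λ R → IsPlanarEmbedding R × CollocatedWrt R k (y C) (x C) (z C) (u C) (v C) (w C)

AvoidingPath : ∀ {n} {G : Graph n} {k} → Config G k → Fin n → Fin n → List (Fin n) → Set
AvoidingPath {G = G} C a b vs = Path G a b vs × All (λ c → ¬ InConfig C c) (interior vs)

-- D0 C a b m : d₀(a,b) = m, where nothing stands for ∞ (no avoiding path)
D0 : ∀ {n} {G : Graph n} {k} → Config G k → Fin n → Fin n → Maybe ℕ → Set
D0 C a b (just d) =
  (∃[ vs ] (AvoidingPath C a b vs × len vs ≡ d)) ×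
  (∀ vs → AvoidingPath C a b vs → d ≤ len vs)
D0 C a b nothing = ∀ vs → ¬ AvoidingPath C a b vs

InS0 : ∀ {n} {G : Graph n} {k} → Config G k → Fin n → Fin n → Fin n → Set
InS0 C a b c =
  ∃[ d ] (D0 C a b (just d) × ∃[ vs ] (AvoidingPath C a b vs × len vs ≡ d × c ∈ vs))

IsCutpoint : ∀ {n} → Graph n → (Fin n → Set) → Fin n → Set
IsCutpoint {n} G S c =
  S c × ∃[ a ] ∃[ b ] (S a × S b × a ≢ c × b ≢ c ×
    ¬ (∃[ vs ] (Walk G a b vs × All (λ e → S e × e ≢ c) vs)))

Position : ℕ → ℕ → ℕ → Set
Position k n n' = Fin k → Maybe (Fin n × Fin n')

PartialIso : ∀ {k n n'} → Graph n → Graph n' → Position k n n' → Set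
PartialIso G G' p =
  ∀ i j a a' b b' → p i ≡ just (a , a') → p j ≡ just (b , b') →
    ((a ≡ b → a' ≡ b') × (a' ≡ b' → a ≡ b)) × adj G a b ≡ adj G' a' b'

place : ∀ {k n n'} → Position k n n' → Fin k → Fin n × Fin n' → Position k n n'
place p i ab j = if does (j ≟ i) then just ab else p j

SpoilerWins : ∀ {k n n'} → Graph n → Graph n' → ℕ → Position k n n' → Set
SpoilerWins G G' zero    p = ¬ PartialIso G G' p
SpoilerWins {k} {n} {n'} G G' (suc r) p =
  ¬ PartialIso G G' p ⊎
  ∃[ i ] ((Σ (Fin n) λ a → ∀ (a' : Fin n') → SpoilerWins G G' r (place p i (a , a'))) ⊎
          (Σ (Fin n') λ a' → ∀ (a : Fin n) → SpoilerWins G G' r (place p i (a , a'))))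

-- r < 2 log₂ n + 2   (for r ≥ 2 equivalent to 2^(r-2) < n²)
LtTwoLog2Plus2 : ℕ → ℕ → Set
LtTwoLog2Plus2 r n = r < 2 ⊎ (2 ≤ r × 2 ^ (r ∸ 2) < n * n)

initialPosition : ∀ {n n'} {G : Graph n} {G' : Graph n'} (k : Kind) →
  Config G k → Config G' k → (s t c : Fin n) → (s' t' c' : Fin n') → Position 12 n n'
initialPosition k C C' s t c s' t' c' i with toℕ i
... | 0 = just (x C , x C')
... | 1 = just (y C , y C')
... | 2 = just (u C , u C')
... | 3 = just (v C , v C')
... | 4 = just (w C , w C')
... | 5 = zPebble k
  where
    zPebble : Kind → Maybe _
    zPebble X = nothing
    zPebble H = just (z C , z C')
... | 6 = just (s , s')
... | 7 = just (t , t')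
... | 8 = just (c , c')
... | _ = nothing

{-# OPTIONS --safe #-}
module Submission where

open import Defs
open import Data.Nat
  using (ℕ; zero; suc; _+_; _*_; _^_; _<_; _≤_; z≤n; s≤s; z<s; s<s; _<?_; _≤?_; ⌊_/2⌋; ⌈_/2⌉)
open import Data.Nat.Properties
open import Data.Fin as Fin using (Fin; toℕ; #_)
open import Data.Fin.Properties using (any?; injective⇒≤) renaming (_≟_ to _≟ᶠ_)
open import Data.Bool using (true)
open import Data.Bool.Properties using () renaming (_≟_ to _≟ᵇ_)
open import Data.Maybe using (just; nothing)
import Data.Maybe as Maybe
open import Data.Product using (∃₂; ∃-syntax; _×_; _,_; proj₁; proj₂; swap; map₁)
open import Data.Sum as Sum using (_⊎_; inj₁; inj₂)
open import Data.Empty using (⊥; ⊥-elim)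
open import Data.List using (List; []; _∷_; length; lookup)
open import Data.List.Membership.Propositional using (_∈_; _∉_)
open import Data.List.Membership.Propositional.Properties using (∈-lookup)
open import Data.List.Relation.Unary.Any using (here; there)
open import Data.List.Relation.Unary.All as All using (All; []; _∷_)
open import Data.List.Relation.Unary.All.Properties using (¬Any⇒All¬)
open import Data.List.Relation.Unary.AllPairs using ([]; _∷_)
open import Data.List.Relation.Unary.Unique.Propositional using (Unique)
open import Function using (_∘_; id)
open import Function.Definitions using (Injective)
open import Level using (0ℓ)
open import Relation.Nullary using (¬_; Dec; yes; no)
open import Relation.Nullary.Decidable using (True; toWitness; map′; _×-dec_; _⊎-dec_; ¬?)
open import Relation.Unary using (Pred; Decidable; _∪_; ｛_｝; ∁; _⊆_)
open import Relation.Unary.Properties using (_∪?_)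
open import Relation.Binary.PropositionalEquality hiding ([_])

-- Only distances avoiding the configurations matter: pebbles 0–5 keep the configurations
-- pebbled, so Duplicator can never answer inside them, and by bisection Spoiler exposes in
-- ⌈log₂ k⌉ rounds any pebbled pair a, b whose avoiding distance is at most k when that of the
-- partners a′, b′ is not.  If c is a cutpoint of G[S₀(s,t)], every shortest avoiding s-t path
-- runs through c, with c at distance i from s and j from t (i + j = d₀).  In G′, either c′
-- violates these distances, or, c′ not being a cutpoint, some shortest avoiding s′-t′ path misses
-- c′; Spoiler pebbles its vertex at distance i from s′, and Duplicator's answer, not being c, is
-- too far from s or from t.  This takes 1 + ⌈log₂ d₀⌉ rounds.

unique⇒lookup-injective : ∀ {A : Set} {xs : List A} → Unique xs → Injective _≡_ _≡_ (lookup xs)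
unique⇒lookup-injective (_ ∷ _)  {Fin.zero}  {Fin.zero}  _  = refl
unique⇒lookup-injective (x∉ ∷ _) {Fin.zero}  {Fin.suc j} eq = ⊥-elim (All.lookup x∉ (∈-lookup j) eq)
unique⇒lookup-injective (x∉ ∷ _) {Fin.suc i} {Fin.zero}  eq = ⊥-elim (All.lookup x∉ (∈-lookup i) (sym eq))
unique⇒lookup-injective (_ ∷ u)  {Fin.suc i} {Fin.suc j} eq = cong Fin.suc (unique⇒lookup-injective u eq)

unique-length≤ : ∀ {n} {xs : List (Fin n)} → Unique xs → length xs ≤ n
unique-length≤ u = injective⇒≤ (unique⇒lookup-injective u)

All-dropLast⇒All-interior : ∀ {A : Set} {P : Pred A 0ℓ} xs → All P (dropLast xs) → All P (interior xs)
All-dropLast⇒All-interior []          _        = []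
All-dropLast⇒All-interior (_ ∷ [])    _        = []
All-dropLast⇒All-interior (_ ∷ _ ∷ _) (_ ∷ ps) = ps

dropLast⁺ : ∀ {A : Set} {P : Pred A 0ℓ} {xs} → All P xs → All P (dropLast xs)
dropLast⁺ []           = []
dropLast⁺ (_ ∷ [])     = []
dropLast⁺ (p ∷ q ∷ ps) = p ∷ dropLast⁺ (q ∷ ps)

interior⁺ : ∀ {A : Set} {P : Pred A 0ℓ} {xs} → All P xs → All P (interior xs)
interior⁺ []       = []
interior⁺ (_ ∷ ps) = dropLast⁺ ps

_∖_ : ∀ {A : Set} → Pred A 0ℓ → A → Pred A 0ℓ
(S ∖ c) e = S e × e ≢ c

module WalkProperties {n} (G : Graph n) where

  private variable
    a b c s t : Fin n
    vs : List (Fin n)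
    P : Pred (Fin n) 0ℓ

  Adj-sym : Adj G a b → Adj G b a
  Adj-sym {a} {b} e = trans (adj-sym G b a) e

  Adj-irrefl : Adj G a b → a ≢ b
  Adj-irrefl {a} e refl with () ← trans (sym e) (adj-irr G a)

  start∈ : Walk G a b vs → a ∈ vs
  start∈ [ a ]   = here refl
  start∈ (_ ∷ _) = here refl

  end∈ : Walk G a b vs → b ∈ vs
  end∈ [ a ]   = here refl
  end∈ (_ ∷ w) = there (end∈ w)

  length-walk : Walk G a b vs → length vs ≡ suc (len vs)
  length-walk [ a ]   = refl
  length-walk (_ ∷ _) = refl

  ∈⇒end-or-init : Walk G a b vs → c ∈ vs → c ≡ b ⊎ c ∈ dropLast vs
  ∈⇒end-or-init [ a ]                (here refl)          = inj₁ refl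
  ∈⇒end-or-init (_ ∷ [ b ])          (here refl)          = inj₂ (here refl)
  ∈⇒end-or-init (_ ∷ [ b ])          (there (here refl))  = inj₁ refl
  ∈⇒end-or-init (_ ∷ w@(_ ∷ _))      (here refl)          = inj₂ (here refl)
  ∈⇒end-or-init (_ ∷ w@(_ ∷ _))      (there c∈)           = Sum.map₂ there (∈⇒end-or-init w c∈)

  ∈⇒end-or-interior : Walk G a b vs → c ∈ vs → c ≡ a ⊎ c ≡ b ⊎ c ∈ interior vs
  ∈⇒end-or-interior [ a ]   (here refl) = inj₁ refl
  ∈⇒end-or-interior (_ ∷ _) (here refl) = inj₁ refl
  ∈⇒end-or-interior (_ ∷ w) (there c∈)  = inj₂ (∈⇒end-or-init w c∈)

  All-dropLast : Walk G a b vs → P a → All P (interior vs) → All P (dropLast vs)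
  All-dropLast [ a ]          _  _  = []
  All-dropLast (_ ∷ [ b ])    pa _  = pa ∷ []
  All-dropLast (_ ∷ (_ ∷ _))  pa ps = pa ∷ ps

  suffix : Walk G s b vs → a ∈ vs →
    ∃[ qs ] (Walk G a b qs × (Unique vs → Unique qs) ×
             (All P (interior vs) → All P (interior qs)) × len qs ≤ len vs)
  suffix w@([ _ ]) (here refl) = _ , w , id , id , ≤-refl
  suffix w@(_ ∷ _) (here refl) = _ , w , id , id , ≤-refl
  suffix {vs = _ ∷ vs} (_ ∷ w) (there a∈) with suffix w a∈
  ... | qs , w′ , uniq , int , len≤ =
    qs , w′ , (λ { (_ ∷ u) → uniq u }) , int ∘ All-dropLast⇒All-interior vs ,
    ≤-trans len≤ (m∸n≤m (length vs) 1)

  Linked : Pred (Fin n) 0ℓ → Fin n → Fin n → Set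
  Linked P a b = ∃[ vs ] (Walk G a b vs × All P vs)

  linked-end : Linked P a b → P b
  linked-end (_ , w , ps) = All.lookup ps (end∈ w)

  linked-map : ∀ {Q : Pred (Fin n) 0ℓ} → P ⊆ Q → Linked P a b → Linked Q a b
  linked-map P⊆Q (vs , w , ps) = vs , w , All.map P⊆Q ps

  linked-trans : Linked P a b → Linked P b c → Linked P a c
  linked-trans (_ , [ a ] , _)      l = l
  linked-trans (_ , e ∷ w , p ∷ ps) l with linked-trans (_ , w , ps) l
  ... | _ , w′ , ps′ = _ , e ∷ w′ , p ∷ ps′

  linked-edge : Adj G a b → P a → P b → Linked P a b
  linked-edge e pa pb = _ , e ∷ [ _ ] , pa ∷ pb ∷ []

  linked-sym : Linked P a b → Linked P b a
  linked-sym l@(_ , [ a ] , _) = l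
  linked-sym (_ , e ∷ w , p ∷ ps) =
    linked-trans (linked-sym (_ , w , ps)) (linked-edge (Adj-sym e) (All.lookup ps (start∈ w)) p)

  linked-via-ends : Linked P a s ⊎ Linked P a t → Linked P b s ⊎ Linked P b t → Linked P s t → Linked P a b
  linked-via-ends (inj₁ as) (inj₁ bs) _  = linked-trans as (linked-sym bs)
  linked-via-ends (inj₂ at) (inj₂ bt) _  = linked-trans at (linked-sym bt)
  linked-via-ends (inj₁ as) (inj₂ bt) st = linked-trans as (linked-trans st (linked-sym bt))
  linked-via-ends (inj₂ at) (inj₁ bs) st = linked-trans at (linked-trans (linked-sym st) (linked-sym bs))

  suffix-linked : Walk G s t vs → a ∈ vs → c ∉ vs → Linked ((_∈ vs) ∖ c) a t
  suffix-linked w@([ _ ]) (here refl) c∉ = _ , w , All.tabulate (λ e∈ → e∈ , λ { refl → c∉ e∈ })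
  suffix-linked w@(_ ∷ _) (here refl) c∉ = _ , w , All.tabulate (λ e∈ → e∈ , λ { refl → c∉ e∈ })
  suffix-linked (_ ∷ w) (there a∈)  c∉ = linked-map (map₁ there) (suffix-linked w a∈ (c∉ ∘ there))

  -- On a path, c ≠ a cannot occur both before and after a.
  path-linked-to-end : Walk G s t vs → Unique vs → a ∈ vs → c ≢ a →
    Linked ((_∈ vs) ∖ c) a s ⊎ Linked ((_∈ vs) ∖ c) a t
  path-linked-to-end [ _ ] _ (here refl) c≢a = inj₁ (_ , [ _ ] , (here refl , ≢-sym c≢a) ∷ [])
  path-linked-to-end (_ ∷ _) _ (here refl) c≢a = inj₁ (_ , [ _ ] , (here refl , ≢-sym c≢a) ∷ [])
  path-linked-to-end {s = s} {c = c} (e ∷ w) (s∉ ∷ u) (there a∈) c≢a with s ≟ᶠ c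
  ... | yes refl = inj₂ (linked-map (map₁ there) (suffix-linked w a∈ (λ c∈ → All.lookup s∉ c∈ refl)))
  ... | no s≢c with path-linked-to-end w u a∈ c≢a
  ...   | inj₂ l = inj₂ (linked-map (map₁ there) l)
  ...   | inj₁ l = inj₁ (linked-trans (linked-map (map₁ there) l)
                     (linked-edge (Adj-sym e) (there (start∈ w) , proj₂ (linked-end l)) (here refl , s≢c)))

module AvoidingWalks {n} (G : Graph n) where
  open WalkProperties G
  open import Data.List.Membership.DecPropositional (_≟ᶠ_ {n}) using (_∈?_)

  -- Walks of length L whose interior vertices lie outside Z; the endpoints are unconstrained.
  data AvoidingWalk (Z : Pred (Fin n) 0ℓ) : ℕ → Fin n → Fin n → Set where
    nil  : ∀ {a} → AvoidingWalk Z 0 a a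
    one  : ∀ {a b} → Adj G a b → AvoidingWalk Z 1 a b
    cons : ∀ {a m b L} → Adj G a m → ¬ Z m → AvoidingWalk Z (suc L) m b → AvoidingWalk Z (suc (suc L)) a b

  Reaches : Pred (Fin n) 0ℓ → ℕ → Fin n → Fin n → Set
  Reaches Z k a b = ∃[ L ] (L ≤ k × AvoidingWalk Z L a b)

  SplitAt : Pred (Fin n) 0ℓ → Fin n → ℕ → Fin n → Fin n → Set
  SplitAt Z c L a b = ∃₂ λ i j → i + j ≡ L × AvoidingWalk Z i a c × AvoidingWalk Z j c b

  module _ {Z : Pred (Fin n) 0ℓ} where

    private variable
      a b c m : Fin n
      i j L : ℕ
      vs : List (Fin n)

    nonempty : a ≢ b → AvoidingWalk Z L a b → 0 < L
    nonempty a≢b nil          = ⊥-elim (a≢b refl)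
    nonempty _   (one _)      = z<s
    nonempty _   (cons _ _ _) = z<s

    weaken : ∀ {Y} → Y ⊆ Z → AvoidingWalk Z L a b → AvoidingWalk Y L a b
    weaken Y⊆Z nil            = nil
    weaken Y⊆Z (one e)        = one e
    weaken Y⊆Z (cons e m∉ w)  = cons e (m∉ ∘ Y⊆Z) (weaken Y⊆Z w)

    append : AvoidingWalk Z i a m → ¬ Z m → AvoidingWalk Z j m b → AvoidingWalk Z (i + j) a b
    append nil           _  w′ = w′
    append (one e)       _  nil = one e
    append (one e)       m∉ w′@(one _) = cons e m∉ w′
    append (one e)       m∉ w′@(cons _ _ _) = cons e m∉ w′
    append (cons e c∉ w) m∉ w′ = cons e c∉ (append w m∉ w′)

    reaches-append : Reaches Z i a m → ¬ Z m → Reaches Z j m b → Reaches Z (i + j) a b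
    reaches-append (_ , L≤i , w) m∉ (_ , L′≤j , w′) = _ , +-mono-≤ L≤i L′≤j , append w m∉ w′

    reaches-mono : i ≤ j → Reaches Z i a b → Reaches Z j a b
    reaches-mono i≤j (L , L≤i , w) = L , ≤-trans L≤i i≤j , w

    split : AvoidingWalk Z (i + j) a b → 0 < i → 0 < j →
      ∃[ m ] (¬ Z m × AvoidingWalk Z i a m × AvoidingWalk Z j m b)
    split {i = 1}           {j = suc _} (cons e m∉ w) _ _ = _ , m∉ , one e , w
    split {i = suc (suc i)} (cons e c∉ w) _ 0<j with split {i = suc i} w z<s 0<j
    ... | m , m∉ , w₁ , w₂ = m , m∉ , cons e c∉ w₁ , w₂

    bisect : ∀ {K} → AvoidingWalk Z L a b → 2 ≤ L → L ≤ 2 * K →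
      ∃₂ λ i j → i + j ≡ L × i ≤ K × j ≤ K × ∃[ m ] (¬ Z m × AvoidingWalk Z i a m × AvoidingWalk Z j m b)
    bisect {L = L} {K = K} w 2≤L L≤2K =
      ⌊ L /2⌋ , ⌈ L /2⌉ , ⌊n/2⌋+⌈n/2⌉≡n L , ≤-trans (⌊n/2⌋≤⌈n/2⌉ L) ⌈L/2⌉≤K , ⌈L/2⌉≤K ,
      split (subst (λ L → AvoidingWalk Z L _ _) (sym (⌊n/2⌋+⌈n/2⌉≡n L)) w) 0<⌊L/2⌋
            (≤-trans 0<⌊L/2⌋ (⌊n/2⌋≤⌈n/2⌉ L))
      where
      0<⌊L/2⌋ : 0 < ⌊ L /2⌋
      0<⌊L/2⌋ = ⌊n/2⌋-mono 2≤L
      ⌈L/2⌉≤K : ⌈ L /2⌉ ≤ K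
      ⌈L/2⌉≤K = ≤-trans (⌈n/2⌉-mono L≤2K)
                  (≤-reflexive (trans (cong ⌈_/2⌉ (cong (K +_) (+-identityʳ K))) (sym (n≡⌈n+n/2⌉ K))))

    avoid-or-through : ∀ c → AvoidingWalk Z L a b →
      AvoidingWalk (Z ∪ ｛ c ｝) L a b ⊎
      ∃₂ λ i j → i < L × j < L × AvoidingWalk Z i a c × AvoidingWalk Z j c b
    avoid-or-through c nil = inj₁ nil
    avoid-or-through c (one e) = inj₁ (one e)
    avoid-or-through c (cons {m = m} e m∉ w) with c ≟ᶠ m
    ... | yes refl = inj₂ (1 , _ , s<s z<s , ≤-refl , one e , w)
    ... | no c≢m with avoid-or-through c w
    ...   | inj₁ w′ = inj₁ (cons e Sum.[ m∉ , c≢m ] w′)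
    ...   | inj₂ (i , j , i<L , j<L , w₁ , w₂) =
      inj₂ (suc i , j , s<s i<L , m<n⇒m<1+n j<L , append (one e) m∉ w₁ , w₂)

    avoidingWalk? : Decidable Z → ∀ L a b → Dec (AvoidingWalk Z L a b)
    avoidingWalk? Z? 0 a b = map′ (λ { refl → nil }) (λ { nil → refl }) (a ≟ᶠ b)
    avoidingWalk? Z? 1 a b = map′ one (λ { (one e) → e }) (adj G a b ≟ᵇ true)
    avoidingWalk? Z? (suc (suc L)) a b =
      map′ (λ (_ , e , m∉ , w) → cons e m∉ w) (λ { (cons e m∉ w) → _ , e , m∉ , w })
           (any? λ m → adj G a m ≟ᵇ true ×-dec ¬? (Z? m) ×-dec avoidingWalk? Z? (suc L) m b)

    reaches? : Decidable Z → ∀ k a b → Dec (Reaches Z k a b)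
    reaches? Z? zero a b = map′ (λ w → 0 , z≤n , w) (λ { (_ , z≤n , w) → w }) (avoidingWalk? Z? 0 a b)
    reaches? Z? (suc k) a b =
      map′ Sum.[ reaches-mono (n≤1+n k) , (λ w → suc k , ≤-refl , w) ] shorter-or-exact
           (reaches? Z? k a b ⊎-dec avoidingWalk? Z? (suc k) a b)
      where
      shorter-or-exact : Reaches Z (suc k) a b → Reaches Z k a b ⊎ AvoidingWalk Z (suc k) a b
      shorter-or-exact (L , L≤ , w) with m≤n⇒m<n∨m≡n L≤
      ... | inj₁ L<   = inj₁ (L , ≤-pred L< , w)
      ... | inj₂ refl = inj₂ w

    fromWalk : Walk G a b vs → All (∁ Z) (interior vs) → AvoidingWalk Z (len vs) a b
    fromWalk [ _ ]                _         = nil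
    fromWalk (e ∷ [ _ ])          _         = one e
    fromWalk (e ∷ w@(_ ∷ [ _ ]))  (m∉ ∷ _)  = cons e m∉ (fromWalk w [])
    fromWalk (e ∷ w@(_ ∷ _ ∷ _))  (m∉ ∷ ms) = cons e m∉ (fromWalk w ms)

    private
      prepend : Adj G a m → ¬ Z m → SplitAt Z c L m b → SplitAt Z c (suc L) a b
      prepend e m∉ (i , j , i+j≡ , w₁ , w₂) = suc i , j , cong suc i+j≡ , append (one e) m∉ w₁ , w₂

    splitAt-∈ : Walk G a b vs → All (∁ Z) (interior vs) → c ∈ vs → SplitAt Z c (len vs) a b
    splitAt-∈ w@([ _ ])           ms        (here refl)        = 0 , _ , refl , nil , fromWalk w ms
    splitAt-∈ w@(_ ∷ _)           ms        (here refl)        = 0 , _ , refl , nil , fromWalk w ms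
    splitAt-∈ (e ∷ [ _ ])         _         (there (here refl)) = 1 , 0 , refl , one e , nil
    splitAt-∈ (e ∷ w@(_ ∷ [ _ ])) (m∉ ∷ _)  (there c∈)         = prepend e m∉ (splitAt-∈ w [] c∈)
    splitAt-∈ (e ∷ w@(_ ∷ _ ∷ _)) (m∉ ∷ ms) (there c∈)         = prepend e m∉ (splitAt-∈ w ms c∈)

    toPath : AvoidingWalk Z L a b → ∃[ vs ] (Path G a b vs × All (∁ Z) (interior vs) × len vs ≤ L)
    toPath nil     = _ , ([ _ ] , [] ∷ []) , [] , z≤n
    toPath (one e) = _ , (e ∷ [ _ ] , (Adj-irrefl e ∷ []) ∷ [] ∷ []) , [] , ≤-refl
    toPath {a = a} (cons e m∉ w) with toPath w
    ... | vs , (w′ , u) , ms , len≤ with a ∈? vs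
    ...   | yes a∈ with suffix w′ a∈
    ...     | qs , w″ , uniq , int , len≤′ = qs , (w″ , uniq u) , int ms , ≤-trans len≤′ (m≤n⇒m≤1+n len≤)
    toPath {a = a} (cons e m∉ w) | vs , (w′ , u) , ms , len≤ | no a∉ =
      a ∷ vs , (e ∷ w′ , ¬Any⇒All¬ vs a∉ ∷ u) , All-dropLast w′ m∉ ms ,
      subst (_≤ _) (sym (length-walk w′)) (s≤s len≤)

module ShortestAvoidingPaths {n} {G : Graph n} {k} (C : Config G k) where
  open WalkProperties G
  open AvoidingWalks G
  open import Data.List.Membership.DecPropositional (_≟ᶠ_ {n}) using (_∈?_)

  inConfig? : Decidable (InConfig C)
  inConfig? a = a ≟ᶠ x C ⊎-dec a ≟ᶠ y C ⊎-dec a ≟ᶠ z C ⊎-dec a ≟ᶠ u C ⊎-dec a ≟ᶠ v C ⊎-dec a ≟ᶠ w C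

  private variable
    a b c s t : Fin n
    d L : ℕ
    vs : List (Fin n)

  d0-minimal : D0 C s t (just d) → AvoidingWalk (InConfig C) L s t → d ≤ L
  d0-minimal (_ , minimal) w with toPath w
  ... | vs , path , ms , len≤ = ≤-trans (minimal vs (path , ms)) len≤

  d0-unique : ∀ {d′} → D0 C s t (just d) → D0 C s t (just d′) → d ≡ d′
  d0-unique ((vs , p , refl) , minimal) ((vs′ , p′ , refl) , minimal′) =
    ≤-antisym (minimal vs′ p′) (minimal′ vs p)

  S0-empty : D0 C s t nothing → ¬ InS0 C s t a
  S0-empty D (_ , _ , vs , p , _) = D vs p

  S0-split : D0 C s t (just d) → InS0 C s t a → SplitAt (InConfig C) a d s t
  S0-split D (_ , D′ , _ , ((w , _) , ms) , refl , a∈) with splitAt-∈ w ms a∈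
  ... | i , j , i+j≡ , w₁ , w₂ = i , j , trans i+j≡ (d0-unique D′ D) , w₁ , w₂

  S0-end-or-outside : InS0 C s t a → a ≡ s ⊎ a ≡ t ⊎ ¬ InConfig C a
  S0-end-or-outside (_ , _ , _ , ((w , _) , ms) , _ , a∈) =
    Sum.map₂ (Sum.map₂ (All.lookup ms)) (∈⇒end-or-interior w a∈)

  S0-linked-to-end : InS0 C s t a → a ≢ c →
    Linked (InS0 C s t ∖ c) a s ⊎ Linked (InS0 C s t ∖ c) a t
  S0-linked-to-end {s = s} {t = t} {c = c} (d , D , vs , p@((w , u) , _) , len≡ , a∈) a≢c =
    Sum.map (linked-map on-path) (linked-map on-path) (path-linked-to-end w u a∈ (≢-sym a≢c))
    where
    on-path : (_∈ vs) ∖ c ⊆ InS0 C s t ∖ c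
    on-path (e∈ , e≢c) = (d , D , vs , p , len≡ , e∈) , e≢c

  shortest-path : ∀ {Z} → InConfig C ⊆ Z → D0 C s t (just d) → AvoidingWalk Z L s t → L ≤ d →
    ∃[ vs ] (Walk G s t vs × All (∁ Z) (interior vs) × All (InS0 C s t) vs × len vs ≡ d)
  shortest-path {s = s} {t = t} {d = d} C⊆Z D w L≤d with toPath w
  ... | vs , (w′ , u) , ms , len≤ =
    vs , w′ , ms , All.tabulate (λ a∈ → _ , D , vs , p , len≡d , a∈) , len≡d
    where
    p : AvoidingPath C s t vs
    p = (w′ , u) , All.map (_∘ C⊆Z) ms
    len≡d : len vs ≡ d
    len≡d = ≤-antisym (≤-trans len≤ L≤d) (proj₂ D vs p)

  -- The metric form of "c is a cutpoint of G[S₀(s,t)]" when d₀(s,t) = d.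
  record Separator (s t c : Fin n) (d : ℕ) : Set where
    field
      s≢c : s ≢ c
      t≢c : t ≢ c
      c∉C : ¬ InConfig C c
      {before after} : ℕ
      before+after≡d : before + after ≡ d
      to-c   : AvoidingWalk (InConfig C) before s c
      from-c : AvoidingWalk (InConfig C) after c t
      separates : ∀ {L} → L ≤ d → ¬ AvoidingWalk (InConfig C ∪ ｛ c ｝) L s t

    0<before : 0 < before
    0<before = nonempty s≢c to-c

    0<after : 0 < after
    0<after = nonempty (≢-sym t≢c) from-c

    before≤d : before ≤ d
    before≤d = subst (before ≤_) before+after≡d (m≤m+n before after)

    after≤d : after ≤ d
    after≤d = subst (after ≤_) before+after≡d (m≤n+m after before)

    before<d : before < d
    before<d = subst (before <_) before+after≡d (m<m+n before 0<after)

  cutpoint⇒separator : D0 C s t (just d) → IsCutpoint G (InS0 C s t) c → Separator s t c d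
  cutpoint⇒separator {s = s} {t = t} {d = d} {c = c} D (c∈S , a , b , a∈S , b∈S , a≢c , b≢c , ¬a~b) =
    let (i , j , i+j≡d , w₁ , w₂) = S0-split D c∈S in
    record { s≢c = s≢c ; t≢c = t≢c ; c∉C = c∉C ; before+after≡d = i+j≡d
           ; to-c = w₁ ; from-c = w₂ ; separates = separates }
    where
    S∖c : Pred (Fin n) 0ℓ
    S∖c = InS0 C s t ∖ c

    a~ : Linked S∖c a s ⊎ Linked S∖c a t
    a~ = S0-linked-to-end a∈S a≢c

    b~ : Linked S∖c b s ⊎ Linked S∖c b t
    b~ = S0-linked-to-end b∈S b≢c

    other-end : ∀ {e f g} → e ≡ c → Linked S∖c g e ⊎ Linked S∖c g f → Linked S∖c g f
    other-end e≡c = Sum.[ (λ l → ⊥-elim (proj₂ (linked-end l) e≡c)) , id ]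

    s≢c : s ≢ c
    s≢c s≡c = ¬a~b (linked-trans (other-end s≡c a~) (linked-sym (other-end s≡c b~)))

    t≢c : t ≢ c
    t≢c t≡c = ¬a~b (linked-trans (other-end t≡c (Sum.swap a~)) (linked-sym (other-end t≡c (Sum.swap b~))))

    c∉C : ¬ InConfig C c
    c∉C with S0-end-or-outside c∈S
    ... | inj₁ c≡s        = ⊥-elim (s≢c (sym c≡s))
    ... | inj₂ (inj₁ c≡t) = ⊥-elim (t≢c (sym c≡t))
    ... | inj₂ (inj₂ c∉)  = c∉

    separates : ∀ {L} → L ≤ d → ¬ AvoidingWalk (InConfig C ∪ ｛ c ｝) L s t
    separates L≤d w with shortest-path inj₁ D w L≤d
    ... | vs , w′ , ms , on-S0 , _ =
      ¬a~b (linked-via-ends a~ b~ (vs , w′ , All.tabulate (λ e∈ → All.lookup on-S0 e∈ , ≢c e∈)))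
      where
      ≢c : ∀ {e} → e ∈ vs → e ≢ c
      ≢c e∈ with ∈⇒end-or-interior w′ e∈
      ... | inj₁ refl        = s≢c
      ... | inj₂ (inj₁ refl) = t≢c
      ... | inj₂ (inj₂ e∈′)  = λ e≡c → All.lookup ms e∈′ (inj₂ (sym e≡c))

  module _ {s t c : Fin n} {d : ℕ} (D : D0 C s t (just d)) (S : Separator s t c d) where
    open Separator S

    -- A walk through a that met c would give a walk through c shorter than d; one missing c
    -- contradicts separates.
    separator-layer : ¬ InConfig C a → a ≢ c →
      Reaches (InConfig C) before s a → Reaches (InConfig C) after a t → ⊥
    separator-layer a∉ a≢c (i , i≤ , w₁) (j , j≤ , w₂) with avoid-or-through c w₁
    ... | inj₂ (i′ , _ , i′<i , _ , s→c , _) =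
      <⇒≱ (subst (i′ + after <_) before+after≡d (+-monoˡ-< after (<-≤-trans i′<i i≤)))
          (d0-minimal D (append s→c c∉C from-c))
    ... | inj₁ w₁′ with avoid-or-through c w₂
    ...   | inj₂ (_ , j′ , _ , j′<j , _ , c→t) =
      <⇒≱ (subst (before + j′ <_) before+after≡d (+-monoʳ-< before (<-≤-trans j′<j j≤)))
          (d0-minimal D (append to-c c∉C c→t))
    ...   | inj₁ w₂′ =
      separates (subst (i + j ≤_) before+after≡d (+-mono-≤ i≤ j≤))
                (append w₁′ Sum.[ a∉ , (λ c≡a → a≢c (sym c≡a)) ] w₂′)

    -- Each edge changes the distance from s by at most one, and in S₀ only c lies at distance
    -- exactly before; so a walk from s inside S₀ − c stays closer than before and misses t.
    separator-disconnects : ¬ Linked (InS0 C s t ∖ c) s t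
    separator-disconnects (_ , w , qs) = stays-close w qs (0 , 0<before , nil)
      where
      Close : Pred (Fin n) 0ℓ
      Close a = ∃[ L ] (L < before × AvoidingWalk (InConfig C) L s a)

      t-far : ¬ Reaches (InConfig C) before s t
      t-far (L , L≤ , w) = <⇒≱ (≤-<-trans L≤ before<d) (d0-minimal D w)

      step : (InS0 C s t ∖ c) a → Adj G a b → Close a → Reaches (InConfig C) before s b
      step (a∈S , _) e (L , L< , w) with S0-end-or-outside a∈S
      ... | inj₁ refl        = 1 , 0<before , one e
      ... | inj₂ (inj₁ refl) = ⊥-elim (t-far (L , <⇒≤ L< , w))
      ... | inj₂ (inj₂ a∉)   = L + 1 , subst (_≤ before) (+-comm 1 L) L< , append w a∉ (one e)

      close : (InS0 C s t ∖ c) b → Reaches (InConfig C) before s b → Close b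
      close (b∈S , b≢c) r with S0-split D b∈S
      ... | i , j , i+j≡d , w₁ , w₂ with i <? before
      ...   | yes i< = i , i< , w₁
      ...   | no i≮ with S0-end-or-outside b∈S
      ...     | inj₁ refl        = 0 , 0<before , nil
      ...     | inj₂ (inj₁ refl) = ⊥-elim (t-far r)
      ...     | inj₂ (inj₂ b∉)   = ⊥-elim (separator-layer b∉ b≢c r (j , j≤after , w₂))
        where
        j≤after : j ≤ after
        j≤after = +-cancelˡ-≤ before j after
          (≤-trans (+-monoˡ-≤ j (≮⇒≥ i≮)) (≤-reflexive (trans i+j≡d (sym before+after≡d))))

      stays-close : Walk G a t vs → All (InS0 C s t ∖ c) vs → Close a → ⊥
      stays-close [ _ ]   _        (L , L< , w) = t-far (L , <⇒≤ L< , w)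
      stays-close (e ∷ w) (q ∷ qs) cl = stays-close w qs (close (All.lookup qs (start∈ w)) (step q e cl))

    separator⇒cutpoint : IsCutpoint G (InS0 C s t) c
    separator⇒cutpoint with shortest-path id D (append to-c c∉C from-c) (≤-reflexive before+after≡d)
    ... | vs , w , ms , on-S0 , len≡d with c ∈? vs
    ...   | yes c∈ = All.lookup on-S0 c∈ , s , t , All.lookup on-S0 (start∈ w) , All.lookup on-S0 (end∈ w) ,
                     s≢c , t≢c , separator-disconnects
    ...   | no c∉  =
      ⊥-elim (separates (≤-reflexive len≡d)
                        (fromWalk w (All.zipWith avoid-both (ms , interior⁺ (¬Any⇒All¬ vs c∉)))))
      where
      avoid-both : ∀ {e} → ¬ InConfig C e × c ≢ e → ¬ (InConfig C ∪ ｛ c ｝) e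
      avoid-both (e∉ , c≢e) = Sum.[ e∉ , c≢e ]

  reaches⇒separator : ∀ {i j} → D0 C s t (just d) → s ≢ c → t ≢ c → ¬ InConfig C c →
    Reaches (InConfig C) i s c → Reaches (InConfig C) j c t → i + j ≤ d →
    ¬ Reaches (InConfig C ∪ ｛ c ｝) d s t → Separator s t c d
  reaches⇒separator D s≢c t≢c c∉C (_ , i′≤i , w₁) (_ , j′≤j , w₂) i+j≤d ¬r = record
    { s≢c = s≢c ; t≢c = t≢c ; c∉C = c∉C
    ; before+after≡d = ≤-antisym (≤-trans (+-mono-≤ i′≤i j′≤j) i+j≤d) (d0-minimal D (append w₁ c∉C w₂))
    ; to-c = w₁ ; from-c = w₂
    ; separates = λ L≤d w → ¬r (_ , L≤d , w) }

swapPosition : ∀ {k n n′} → Position k n n′ → Position k n′ n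
swapPosition p = Maybe.map swap ∘ p

module _ {k n n′ : ℕ} where

  private variable
    p : Position k n n′
    q : Position k n′ n
    i j : Fin k
    a : Fin n
    a′ : Fin n′

  swapPosition-just : ∀ (p : Position k n n′) → swapPosition p i ≡ just (a′ , a) → p i ≡ just (a , a′)
  swapPosition-just {i = i} p eq with p i
  swapPosition-just p refl | just _ = refl

  place-same : ∀ (p : Position k n n′) i ab → place p i ab i ≡ just ab
  place-same p i ab with i ≟ᶠ i
  ... | yes _  = refl
  ... | no i≢i = ⊥-elim (i≢i refl)

  place-other : ∀ (p : Position k n n′) ab → j ≢ i → place p i ab j ≡ p j
  place-other {j = j} {i = i} p ab j≢i with j ≟ᶠ i
  ... | yes j≡i = ⊥-elim (j≢i j≡i)
  ... | no _    = refl

  place-swap : (∀ j → q j ≡ swapPosition p j) →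
    ∀ j → place q i (a′ , a) j ≡ swapPosition (place p i (a , a′)) j
  place-swap {i = i} q≗ j with j ≟ᶠ i
  ... | yes _ = refl
  ... | no _  = q≗ j

module PebbleGame {k n n′ : ℕ} (G : Graph n) (G′ : Graph n′) where

  private variable
    p : Position k n n′
    q : Position k n′ n
    i j : Fin k
    a b : Fin n
    a′ b′ : Fin n′

  fail : ∀ r → ¬ PartialIso G G′ p → SpoilerWins G G′ r p
  fail zero    ¬iso = ¬iso
  fail (suc r) ¬iso = inj₁ ¬iso

  spoilerWins-suc : ∀ r → SpoilerWins G G′ r p → SpoilerWins G G′ (suc r) p
  spoilerWins-suc zero    ¬iso                        = inj₁ ¬iso
  spoilerWins-suc (suc r) (inj₁ ¬iso)                 = inj₁ ¬iso
  spoilerWins-suc (suc r) (inj₂ (i , inj₁ (a , win))) = inj₂ (i , inj₁ (a , spoilerWins-suc r ∘ win))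
  spoilerWins-suc (suc r) (inj₂ (i , inj₂ (a , win))) = inj₂ (i , inj₂ (a , spoilerWins-suc r ∘ win))

  ≡-mismatch : p i ≡ just (a , a′) → p j ≡ just (b , b′) → a ≡ b → a′ ≢ b′ → ¬ PartialIso G G′ p
  ≡-mismatch pi pj a≡b a′≢b′ iso = a′≢b′ (proj₁ (proj₁ (iso _ _ _ _ _ _ pi pj)) a≡b)

  ≢-mismatch : p i ≡ just (a , a′) → p j ≡ just (b , b′) → a ≢ b → a′ ≡ b′ → ¬ PartialIso G G′ p
  ≢-mismatch pi pj a≢b a′≡b′ iso = a≢b (proj₂ (proj₁ (iso _ _ _ _ _ _ pi pj)) a′≡b′)

  adj-mismatch : p i ≡ just (a , a′) → p j ≡ just (b , b′) → Adj G a b → ¬ Adj G′ a′ b′ →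
    ¬ PartialIso G G′ p
  adj-mismatch pi pj ab ¬a′b′ iso = ¬a′b′ (trans (sym (proj₂ (iso _ _ _ _ _ _ pi pj))) ab)

  partialIso-swap : (∀ j → q j ≡ swapPosition p j) → PartialIso G G′ p → PartialIso G′ G q
  partialIso-swap {q = q} {p = p} q≗ iso i j a′ a b′ b qi qj
    with iso i j a a′ b b′ (swapPosition-just p (trans (sym (q≗ i)) qi))
                           (swapPosition-just p (trans (sym (q≗ j)) qj))
  ... | (to , from) , adj≡ = (from , to) , sym adj≡

  spoilerWins-swap : ∀ r → (∀ j → q j ≡ swapPosition p j) → SpoilerWins G′ G r q → SpoilerWins G G′ r p
  spoilerWins-swap zero    q≗ ¬iso        = ¬iso ∘ partialIso-swap q≗
  spoilerWins-swap (suc r) q≗ (inj₁ ¬iso) = inj₁ (¬iso ∘ partialIso-swap q≗)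
  spoilerWins-swap (suc r) q≗ (inj₂ (i , inj₁ (a′ , win))) =
    inj₂ (i , inj₂ (a′ , λ a → spoilerWins-swap r (place-swap q≗) (win a)))
  spoilerWins-swap (suc r) q≗ (inj₂ (i , inj₂ (a , win))) =
    inj₂ (i , inj₁ (a , λ a′ → spoilerWins-swap r (place-swap q≗) (win a′)))

Free Fixed : Fin 12 → Set
Free  g = 6 ≤ toℕ g
Fixed g = toℕ g < 6

fixed≢free : ∀ {g ℓ} → Fixed g → Free ℓ → g ≢ ℓ
fixed≢free g<6 6≤ℓ refl = <⇒≱ g<6 6≤ℓ

fixed : ∀ g {g<6 : True (toℕ g <? 6)} → Fixed g
fixed _ {g<6} = toWitness g<6

free : ∀ g {6≤g : True (6 ≤? toℕ g)} → Free g
free _ {6≤g} = toWitness 6≤g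

module _ {n n′ : ℕ} where

  -- The strategy never moves pebbles 0–5, so covering survives every round; it stops Duplicator
  -- from answering inside XB.
  Covers : Pred (Fin n) 0ℓ → Pred (Fin n′) 0ℓ → Position 12 n n′ → Set
  Covers XA XB p = ∀ {b} → XB b → ∃[ g ] (Fixed g × ∃[ a ] (p g ≡ just (a , b) × XA a))

  covers-fixed : ∀ {XA XB} {p q : Position 12 n n′} → Covers XA XB p →
    (∀ {g} → Fixed g → q g ≡ p g) → Covers XA XB q
  covers-fixed cov q≗p b∈ with cov b∈
  ... | g , g-fixed , a , pg , a∈ = g , g-fixed , a , trans (q≗p g-fixed) pg , a∈

FreeTriple : Fin 12 → Fin 12 → Fin 12 → Set
FreeTriple i j ℓ = Free i × Free j × Free ℓ × i ≢ j × j ≢ ℓ × ℓ ≢ i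

freeTriple : ∀ i j ℓ {ok : True (6 ≤? toℕ i ×-dec 6 ≤? toℕ j ×-dec 6 ≤? toℕ ℓ ×-dec
                                 ¬? (i ≟ᶠ j) ×-dec ¬? (j ≟ᶠ ℓ) ×-dec ¬? (ℓ ≟ᶠ i))} → FreeTriple i j ℓ
freeTriple _ _ _ {ok} = toWitness ok

first-half : ∀ {i j ℓ} → FreeTriple i j ℓ → FreeTriple i ℓ j
first-half (fi , fj , fℓ , i≢j , j≢ℓ , ℓ≢i) = fi , fℓ , fj , ≢-sym ℓ≢i , ≢-sym j≢ℓ , ≢-sym i≢j

second-half : ∀ {i j ℓ} → FreeTriple i j ℓ → FreeTriple ℓ j i
second-half (fi , fj , fℓ , i≢j , j≢ℓ , ℓ≢i) = fℓ , fj , fi , ≢-sym j≢ℓ , ≢-sym i≢j , ≢-sym ℓ≢i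

module DistanceGame {n n′} {A : Graph n} {B : Graph n′} {XA : Pred (Fin n) 0ℓ} {XB : Pred (Fin n′) 0ℓ}
                    (XB? : Decidable XB) where
  private
    module WA = AvoidingWalks A
    module WB = AvoidingWalks B
  open PebbleGame {k = 12} A B

  -- Spoiler bisects the walk with the spare pebble ℓ and recurses on a half that Duplicator
  -- cannot match.
  distance-win : ∀ r {p : Position 12 n n′} {i j ℓ a a′ b b′ L} → FreeTriple i j ℓ → Covers XA XB p →
    p i ≡ just (a , a′) → p j ≡ just (b , b′) →
    WA.AvoidingWalk XA L a b → L ≤ 2 ^ r → ¬ WB.Reaches XB L a′ b′ → SpoilerWins A B r p
  distance-win r _ _ pi pj WA.nil _ ¬r =
    fail r (≡-mismatch pi pj refl λ a′≡b′ → ¬r (0 , z≤n , subst (WB.AvoidingWalk XB 0 _) a′≡b′ WB.nil))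
  distance-win r _ _ pi pj (WA.one e) _ ¬r =
    fail r (adj-mismatch pi pj e λ e′ → ¬r (1 , ≤-refl , WB.one e′))
  distance-win zero _ _ _ _ (WA.cons _ _ _) (s≤s ()) _
  distance-win (suc r) {p = p} {ℓ = ℓ} {a′ = a′} {b′ = b′} T@(_ , _ , fℓ , _ , j≢ℓ , ℓ≢i) cov pi pj
               w@(WA.cons _ _ _) L≤ ¬r
    with WA.bisect w (s≤s (s≤s z≤n)) L≤
  ... | L₁ , L₂ , L₁+L₂≡L , L₁≤ , L₂≤ , m , m∉ , w₁ , w₂ = inj₂ (ℓ , inj₁ (m , respond))
    where
    cov′ : ∀ {ab} → Covers XA XB (place p ℓ ab)
    cov′ = covers-fixed cov (λ g-fixed → place-other p _ (fixed≢free g-fixed fℓ))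

    respond : ∀ m′ → SpoilerWins A B r (place p ℓ (m , m′))
    respond m′ with XB? m′
    ... | yes m′∈ with cov m′∈
    ...   | g , g-fixed , v , pg , v∈ =
      fail r (≢-mismatch (trans (place-other p _ (fixed≢free g-fixed fℓ)) pg) (place-same p ℓ _)
                         (λ v≡m → m∉ (subst XA v≡m v∈)) refl)
    respond m′ | no m′∉ with WB.reaches? XB? L₁ a′ m′
    ... | no ¬r₁ =
      distance-win r (first-half T) cov′ (trans (place-other p _ (≢-sym ℓ≢i)) pi) (place-same p ℓ _)
        w₁ L₁≤ ¬r₁
    ... | yes r₁ =
      distance-win r (second-half T) cov′ (place-same p ℓ _) (trans (place-other p _ j≢ℓ) pj) w₂ L₂≤
        (λ r₂ → ¬r (subst (λ L → WB.Reaches XB L a′ b′) L₁+L₂≡L (WB.reaches-append r₁ m′∉ r₂)))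

module CutpointGame {n n′} {A : Graph n} {B : Graph n′} {kA kB} (CA : Config A kA) (CB : Config B kB) where
  private
    module WA = AvoidingWalks A
    module WB = AvoidingWalks B
    module SA = ShortestAvoidingPaths CA
    module SB = ShortestAvoidingPaths CB
    module AB = DistanceGame {A = A} {B = B} {XA = InConfig CA} SB.inConfig?
    module BA = DistanceGame {A = B} {B = A} {XA = InConfig CB} SA.inConfig?
  open PebbleGame {k = 12} A B

  module _ (r : ℕ) (p : Position 12 n n′) {sA tA cA : Fin n} {sB tB cB : Fin n′} {d : ℕ}
           (p₆ : p (# 6) ≡ just (sA , sB)) (p₇ : p (# 7) ≡ just (tA , tB)) (p₈ : p (# 8) ≡ just (cA , cB))
           (covers : Covers (InConfig CA) (InConfig CB) p)
           (covers⁻ : Covers (InConfig CB) (InConfig CA) (swapPosition p))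
           (DA : D0 CA sA tA (just d)) (DB : D0 CB sB tB (just d)) (d≤2^r : d ≤ 2 ^ r)
           (S : SA.Separator sA tA cA d) where
    open SA.Separator S

    -- Spoiler pebbles the vertex at distance before on a c′-avoiding shortest s′-t′ walk;
    -- its partner in G must be closer to s than before or closer to t than after.
    midpoint-win : ∀ {L} → WB.AvoidingWalk (InConfig CB ∪ ｛ cB ｝) L sB tB → L ≤ d →
      SpoilerWins A B (suc r) p
    midpoint-win {L} w L≤d
      with WB.split (subst (λ L → WB.AvoidingWalk _ L sB tB) L≡before+after w) 0<before 0<after
      where
      L≡before+after : L ≡ before + after
      L≡before+after = trans (≤-antisym L≤d (SB.d0-minimal DB (WB.weaken inj₁ w))) (sym before+after≡d)
    ... | m′ , m′∉ , w₁ , w₂ = inj₂ (# 9 , inj₂ (m′ , respond))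
      where
      q : Fin n → Position 12 n n′
      q m = place p (# 9) (m , m′)

      q-keeps : ∀ {j} m → j ≢ # 9 → q m j ≡ p j
      q-keeps m = place-other p (m , m′)

      q-keeps-fixed : ∀ {g} m → Fixed g → q m g ≡ p g
      q-keeps-fixed m g-fixed = q-keeps m (fixed≢free g-fixed (free (# 9)))

      q₉ : ∀ m → q m (# 9) ≡ just (m , m′)
      q₉ m = place-same p (# 9) (m , m′)

      q⁻-covers : ∀ m → Covers (InConfig CB) (InConfig CA) (swapPosition (q m))
      q⁻-covers m = covers-fixed covers⁻ (cong (Maybe.map swap) ∘ q-keeps-fixed m)

      respond : ∀ m → SpoilerWins A B r (q m)
      respond m with m ≟ᶠ cA
      ... | yes m≡c =
        fail r (≡-mismatch {i = # 9} {j = # 8} (q₉ m) (trans (q-keeps m (λ ())) p₈) m≡c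
                           (λ m′≡c → m′∉ (inj₂ (sym m′≡c))))
      ... | no m≢c with SA.inConfig? m
      ...   | yes m∈ with covers⁻ m∈
      ...     | g , g-fixed , v′ , pg , v′∈ =
        fail r (≡-mismatch {i = g} {j = # 9} (trans (q-keeps-fixed m g-fixed) (swapPosition-just p pg))
                           (q₉ m) refl (λ v′≡m′ → m′∉ (inj₁ (subst (InConfig CB) v′≡m′ v′∈))))
      respond m | no m≢c | no m∉ with WA.reaches? SA.inConfig? before sA m
      ... | no ¬r₁ = spoilerWins-swap r (λ _ → refl)
        (BA.distance-win r (freeTriple (# 6) (# 9) (# 10)) (q⁻-covers m)
           (cong (Maybe.map swap) (trans (q-keeps {# 6} m (λ ())) p₆)) (cong (Maybe.map swap) (q₉ m))
           (WB.weaken inj₁ w₁) (≤-trans before≤d d≤2^r) ¬r₁)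
      ... | yes r₁ = spoilerWins-swap r (λ _ → refl)
        (BA.distance-win r (freeTriple (# 9) (# 7) (# 10)) (q⁻-covers m)
           (cong (Maybe.map swap) (q₉ m)) (cong (Maybe.map swap) (trans (q-keeps {# 7} m (λ ())) p₇))
           (WB.weaken inj₁ w₂) (≤-trans after≤d d≤2^r) (SA.separator-layer DA S m∉ m≢c r₁))

    separator-win : ¬ IsCutpoint B (InS0 CB sB tB) cB → SpoilerWins A B (suc r) p
    separator-win ¬cut with cB ≟ᶠ sB
    ... | yes c≡s = fail (suc r) (≢-mismatch p₈ p₆ (s≢c ∘ sym) c≡s)
    ... | no c≢s with cB ≟ᶠ tB
    ...   | yes c≡t = fail (suc r) (≢-mismatch p₈ p₇ (t≢c ∘ sym) c≡t)
    ...   | no c≢t with SB.inConfig? cB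
    ...     | yes c∈ with covers c∈
    ...       | g , g-fixed , v , pg , v∈ =
      fail (suc r) (≢-mismatch p₈ pg (λ c≡v → c∉C (subst (InConfig CA) (sym c≡v) v∈)) refl)
    separator-win ¬cut | no c≢s | no c≢t | no c∉ with WB.reaches? SB.inConfig? before sB cB
    ... | no ¬r₁ = spoilerWins-suc r
      (AB.distance-win r (freeTriple (# 6) (# 8) (# 9)) covers p₆ p₈ to-c (≤-trans before≤d d≤2^r) ¬r₁)
    ... | yes r₁ with WB.reaches? SB.inConfig? after cB tB
    ...   | no ¬r₂ = spoilerWins-suc r
      (AB.distance-win r (freeTriple (# 8) (# 7) (# 9)) covers p₈ p₇ from-c (≤-trans after≤d d≤2^r) ¬r₂)
    ...   | yes r₂ with WB.reaches? (SB.inConfig? ∪? (cB ≟ᶠ_)) d sB tB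
    ...     | yes (_ , L≤d , w) = midpoint-win w L≤d
    ...     | no ¬r = ⊥-elim (¬cut (SB.separator⇒cutpoint DB
                (SB.reaches⇒separator DB (c≢s ∘ sym) (c≢t ∘ sym) c∉ r₁ r₂ (≤-reflexive before+after≡d) ¬r)))

  cutpoint-win : ∀ r (p : Position 12 n n′) {sA tA cA sB tB cB d} →
    p (# 6) ≡ just (sA , sB) → p (# 7) ≡ just (tA , tB) → p (# 8) ≡ just (cA , cB) →
    Covers (InConfig CA) (InConfig CB) p → Covers (InConfig CB) (InConfig CA) (swapPosition p) →
    D0 CA sA tA (just d) → D0 CB sB tB (just d) → d ≤ 2 ^ r →
    IsCutpoint A (InS0 CA sA tA) cA → ¬ IsCutpoint B (InS0 CB sB tB) cB →
    SpoilerWins A B (suc r) p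
  cutpoint-win r p p₆ p₇ p₈ covers covers⁻ DA DB d≤2^r cut =
    separator-win r p p₆ p₇ p₈ covers covers⁻ DA DB d≤2^r (SA.cutpoint⇒separator DA cut)

d0<n : ∀ {n k} {G : Graph n} {C : Config G k} {s t d} → D0 C s t (just d) → d < n
d0<n {G = G} ((vs , ((w , u) , _) , refl) , _) =
  subst (_≤ _) (WalkProperties.length-walk G w) (unique-length≤ u)

least-power-of-2 : ∀ m → ∃[ r ] (m ≤ 2 ^ r × ∀ {r′} → r ≡ suc r′ → 2 ^ r′ < m)
least-power-of-2 zero = 0 , z≤n , λ ()
least-power-of-2 (suc m) with least-power-of-2 m
... | r , m≤2^r , least with suc m ≤? 2 ^ r
...   | yes 1+m≤2^r = r , 1+m≤2^r , λ r≡1+r′ → m<n⇒m<1+n (least r≡1+r′)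
...   | no 1+m≰2^r = suc r , 1+m≤2^[1+r] , λ { refl → ≰⇒> 1+m≰2^r }
  where
  2^r≡m : 2 ^ r ≡ m
  2^r≡m = ≤-antisym (≤-pred (≰⇒> 1+m≰2^r)) m≤2^r
  1+m≤2^[1+r] : suc m ≤ 2 ^ suc r
  1+m≤2^[1+r] = subst (λ m → suc m ≤ 2 ^ suc r) 2^r≡m (+-mono-≤ (m^n>0 2 r) (m≤m+n (2 ^ r) 0))

rounds-bound : ∀ {n d r} → d < n → (∀ {r′} → r ≡ suc r′ → 2 ^ r′ < d) → LtTwoLog2Plus2 (suc r) n
rounds-bound {r = zero} _ _ = inj₁ (s≤s (s≤s z≤n))
rounds-bound {n = suc n} {r = suc r} d<n least =
  inj₂ (s≤s (s≤s z≤n) , <-≤-trans (<-trans (least refl) d<n) (m≤m*n (suc n) (suc n)))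

module _ {n n′} {G : Graph n} {G′ : Graph n′} where

  -- In an X-configuration z = w, and pebble 5 stays off the board while pebble 4 covers z.
  initial-covers : ∀ k (C : Config G k) (C′ : Config G′ k) s t c s′ t′ c′ →
    Covers (InConfig C) (InConfig C′) (initialPosition k C C′ s t c s′ t′ c′)
  initial-covers k C C′ _ _ _ _ _ _ (inj₁ refl) =
    # 0 , fixed (# 0) , _ , refl , inj₁ refl
  initial-covers k C C′ _ _ _ _ _ _ (inj₂ (inj₁ refl)) =
    # 1 , fixed (# 1) , _ , refl , inj₂ (inj₁ refl)
  initial-covers X C C′ _ _ _ _ _ _ (inj₂ (inj₂ (inj₁ refl))) =
    # 4 , fixed (# 4) , _ , cong (λ b → just (w C , b)) (sym (proj₁ (valid C′))) ,
    inj₂ (inj₂ (inj₂ (inj₂ (inj₂ refl))))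
  initial-covers H C C′ _ _ _ _ _ _ (inj₂ (inj₂ (inj₁ refl))) =
    # 5 , fixed (# 5) , _ , refl , inj₂ (inj₂ (inj₁ refl))
  initial-covers k C C′ _ _ _ _ _ _ (inj₂ (inj₂ (inj₂ (inj₁ refl)))) =
    # 2 , fixed (# 2) , _ , refl , inj₂ (inj₂ (inj₂ (inj₁ refl)))
  initial-covers k C C′ _ _ _ _ _ _ (inj₂ (inj₂ (inj₂ (inj₂ (inj₁ refl))))) =
    # 3 , fixed (# 3) , _ , refl , inj₂ (inj₂ (inj₂ (inj₂ (inj₁ refl))))
  initial-covers k C C′ _ _ _ _ _ _ (inj₂ (inj₂ (inj₂ (inj₂ (inj₂ refl))))) =
    # 4 , fixed (# 4) , _ , refl , inj₂ (inj₂ (inj₂ (inj₂ (inj₂ refl))))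

  initial-covers⁻ : ∀ k (C : Config G k) (C′ : Config G′ k) s t c s′ t′ c′ →
    Covers (InConfig C′) (InConfig C) (swapPosition (initialPosition k C C′ s t c s′ t′ c′))
  initial-covers⁻ k C C′ _ _ _ _ _ _ (inj₁ refl) =
    # 0 , fixed (# 0) , _ , refl , inj₁ refl
  initial-covers⁻ k C C′ _ _ _ _ _ _ (inj₂ (inj₁ refl)) =
    # 1 , fixed (# 1) , _ , refl , inj₂ (inj₁ refl)
  initial-covers⁻ X C C′ _ _ _ _ _ _ (inj₂ (inj₂ (inj₁ refl))) =
    # 4 , fixed (# 4) , _ , cong (λ a → just (w C′ , a)) (sym (proj₁ (valid C))) ,
    inj₂ (inj₂ (inj₂ (inj₂ (inj₂ refl))))
  initial-covers⁻ H C C′ _ _ _ _ _ _ (inj₂ (inj₂ (inj₁ refl))) =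
    # 5 , fixed (# 5) , _ , refl , inj₂ (inj₂ (inj₁ refl))
  initial-covers⁻ k C C′ _ _ _ _ _ _ (inj₂ (inj₂ (inj₂ (inj₁ refl)))) =
    # 2 , fixed (# 2) , _ , refl , inj₂ (inj₂ (inj₂ (inj₁ refl)))
  initial-covers⁻ k C C′ _ _ _ _ _ _ (inj₂ (inj₂ (inj₂ (inj₂ (inj₁ refl))))) =
    # 3 , fixed (# 3) , _ , refl , inj₂ (inj₂ (inj₂ (inj₂ (inj₁ refl))))
  initial-covers⁻ k C C′ _ _ _ _ _ _ (inj₂ (inj₂ (inj₂ (inj₂ (inj₂ refl))))) =
    # 4 , fixed (# 4) , _ , refl , inj₂ (inj₂ (inj₂ (inj₂ (inj₂ refl))))

swap-involutive : ∀ {k n n′} (p : Position k n n′) j → swapPosition (swapPosition p) j ≡ p j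
swap-involutive p j with p j
... | just _  = refl
... | nothing = refl

initial-win : ∀ {n n′} {G : Graph n} {G′ : Graph n′} k (C : Config G k) (C′ : Config G′ k) s t c s′ t′ c′
  {d r} → D0 C s t (just d) → D0 C′ s′ t′ (just d) → d ≤ 2 ^ r →
  (IsCutpoint G (InS0 C s t) c × ¬ IsCutpoint G′ (InS0 C′ s′ t′) c′) ⊎
  (IsCutpoint G′ (InS0 C′ s′ t′) c′ × ¬ IsCutpoint G (InS0 C s t) c) →
  SpoilerWins G G′ (suc r) (initialPosition k C C′ s t c s′ t′ c′)
initial-win k C C′ s t c s′ t′ c′ {r = r} D D′ d≤2^r (inj₁ (cut , ¬cut)) =
  CutpointGame.cutpoint-win C C′ r _ refl refl refl
    (initial-covers k C C′ s t c s′ t′ c′) (initial-covers⁻ k C C′ s t c s′ t′ c′) D D′ d≤2^r cut ¬cut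
initial-win {n} {n′} {G} {G′} k C C′ s t c s′ t′ c′ {r = r} D D′ d≤2^r (inj₂ (cut , ¬cut)) =
  PebbleGame.spoilerWins-swap G G′ (suc r) (λ _ → refl)
    (CutpointGame.cutpoint-win C′ C r (swapPosition p₀) refl refl refl
       (initial-covers⁻ k C C′ s t c s′ t′ c′)
       (covers-fixed (initial-covers k C C′ s t c s′ t′ c′) (λ {g} _ → swap-involutive p₀ g))
       D′ D d≤2^r cut ¬cut)
  where
  p₀ : Position 12 n n′
  p₀ = initialPosition k C C′ s t c s′ t′ c′

lemma17 : ∀ {n n'} (G : Graph n) (G' : Graph n') (k : Kind)
    (C : Config G k) (C' : Config G' k) (s t c : Fin n) (s' t' c' : Fin n') →
    Triconnected G → Planar G → Triconnected G' → Planar G' →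
    ¬ Isomorphic G G' →
    Collocated C → Twisted C' →
    (∃[ d ] (D0 C s t d × D0 C' s' t' d)) →
    ((IsCutpoint G (InS0 C s t) c × ¬ IsCutpoint G' (InS0 C' s' t') c') ⊎
     (IsCutpoint G' (InS0 C' s' t') c' × ¬ IsCutpoint G (InS0 C s t) c)) →
    ∃[ r ] (LtTwoLog2Plus2 r n ×
      SpoilerWins G G' r (initialPosition k C C' s t c s' t' c'))
lemma17 G G' k C C' s t c s' t' c' _ _ _ _ _ _ _ (nothing , D , _) (inj₁ (cut , _)) =
  ⊥-elim (ShortestAvoidingPaths.S0-empty C D (proj₁ cut))
lemma17 G G' k C C' s t c s' t' c' _ _ _ _ _ _ _ (nothing , _ , D') (inj₂ (cut , _)) =
  ⊥-elim (ShortestAvoidingPaths.S0-empty C' D' (proj₁ cut))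
lemma17 G G' k C C' s t c s' t' c' _ _ _ _ _ _ _ (just d , D , D') cuts =
  let (r , d≤2^r , least) = least-power-of-2 d in
  suc r , rounds-bound (d0<n {C = C} {s = s} {t = t} D) least ,
  initial-win k C C' s t c s' t' c' D D' d≤2^r cuts
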